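{- If $H^\ast_G(P;z)$ is polynomial, then $H^\ast_{\mathcal H}(P;z)$ is polynomial.
   Context: Let $G$ be a finite group acting linearly on a lattice $M' \cong M \times \mathbb{Z}$ of rank $d+1$ such that the $\mathbb{Z}$-coordinate of lattice points is preserved by the action, via a representation $\rho: G \to \operatorname{GL}(M')$. Let $P \subset M'_{\mathbb{R}} = M'\otimes_{\mathbb{Z}}\mathbb{R}$ be a $d$-dimensional $G$-invariant polytope (i.e. $g(P)=P$ for all $g\in G$) with vertices in $M \times \{1\}$. For $t \ge 0$ let $\chi_{tP}$ be the complex permutation character of the action of $G$ on the lattice points $tP \cap M'$. The equivariant Ehrhart series is $\sum_{t\ge 0}\chi_{tP}z^t = \frac{H^\ast(P;z)}{\det(I - z\cdot\rho)}$, where $H^\ast(P;z)$ is a formal power series with coefficients in the character ring $R(G)$ (integer linear combinations of irreducible characters of $G$). Let $\mathcal H$ be a subgroup of $G$; the action of $G$ on $P$ induces an action of $\mathcal H$ by restriction. Let $H^\ast_G(P;z)$ and $H^\ast_{\mathcal H}(P;z)$ denote the $H^\ast$-series of $P$ with respect to the actions of $G$ and $\mathcal H$, respectively. -}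

module Defs where

open import Level using (Level; _⊔_)
open import Data.Nat as ℕ using (ℕ; zero; suc; _∸_; _≤_)
open import Data.Integer as ℤ using (ℤ; +_; -_)
open import Data.Rational as ℚ using (ℚ)
open import Data.Fin as Fin using (Fin; zero; suc; punchIn; toℕ)
open import Data.List using (List; []; _∷_)
open import Data.Bool using (if_then_else_)
open import Data.Product using (Σ; ∃; _×_; _,_)
open import Relation.Nullary.Decidable using (⌊_⌋)
open import Relation.Binary.PropositionalEquality using (_≡_)
open import Algebra.Bundles using (Group)

sumℤ : ∀ {n} → (Fin n → ℤ) → ℤ
sumℤ {zero}  f = + 0
sumℤ {suc n} f = f zero ℤ.+ sumℤ (λ i → f (suc i))

sumℚ : ∀ {n} → (Fin n → ℚ) → ℚ
sumℚ {zero}  f = ℚ.0ℚ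
sumℚ {suc n} f = f zero ℚ.+ sumℚ (λ i → f (suc i))

sumRange : ℕ → (ℕ → ℤ) → ℤ
sumRange zero    f = f 0
sumRange (suc t) f = sumRange t f ℤ.+ f (suc t)

toℚ : ℤ → ℚ
toℚ z = z ℚ./ 1

Mat : ℕ → ℕ → Set
Mat m n = Fin m → Fin n → ℤ

δ : ∀ {n} → Fin n → Fin n → ℤ
δ i j = if ⌊ i Fin.≟ j ⌋ then + 1 else + 0

idM : ∀ {n} → Mat n n
idM = δ

_·M_ : ∀ {m n p} → Mat m n → Mat n p → Mat m p
(A ·M B) i k = sumℤ (λ j → A i j ℤ.* B j k)

act : ∀ {m n} → Mat m n → (Fin n → ℤ) → Fin m → ℤ
act A y i = sumℤ (λ j → A i j ℤ.* y j)

actℚ : ∀ {m n} → Mat m n → (Fin n → ℚ) → Fin m → ℚ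
actℚ A x i = sumℚ (λ j → toℚ (A i j) ℚ.* x j)

-- Polynomials in z over ℤ as coefficient lists (constant term first)

Poly : Set
Poly = List ℤ

_+P_ : Poly → Poly → Poly
[]      +P q       = q
(a ∷ p) +P []      = a ∷ p
(a ∷ p) +P (b ∷ q) = (a ℤ.+ b) ∷ (p +P q)

scaleP : ℤ → Poly → Poly
scaleP c []      = []
scaleP c (a ∷ p) = (c ℤ.* a) ∷ scaleP c p

_*P_ : Poly → Poly → Poly
[]      *P q = []
(a ∷ p) *P q = scaleP a q +P (+ 0 ∷ (p *P q))

sumP : ∀ {n} → (Fin n → Poly) → Poly
sumP {zero}  f = []
sumP {suc n} f = f zero +P sumP (λ i → f (suc i))

coeff : Poly → ℕ → ℤ
coeff []      _       = + 0
coeff (a ∷ p) zero    = a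
coeff (a ∷ p) (suc i) = coeff p i

detP : ∀ n → (Fin n → Fin n → Poly) → Poly
detP zero    M = + 1 ∷ []
detP (suc n) M =
  sumP (λ j → ((- + 1) ℤ.^ toℕ j ∷ []) *P
              (M zero j *P detP n (λ r c → M (suc r) (punchIn j c))))

detIminuszA : ∀ {n} → Mat n n → Poly
detIminuszA {n} A = detP n (λ i j → δ i j ∷ (- A i j) ∷ [])

-- Lattice M' = ℤ × ℤ^d ≅ ℤ^(d+1); coordinate 'zero' is the ℤ-coordinate
-- (the "height").  A lattice polytope P at height 1 is given by a finite
-- list of lattice points V i ∈ M (its vertices are among them):
-- P = conv { (1 , V i) }.

liftPt : ∀ {d k} → (Fin k → Fin d → ℤ) → Fin k → Fin (suc d) → ℤ
liftPt V i zero    = + 1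
liftPt V i (suc j) = V i j

InCone : ∀ {d k} → (Fin k → Fin d → ℤ) → (Fin (suc d) → ℚ) → Set
InCone {d} {k} V x =
  Σ (Fin k → ℚ) λ λs → (∀ i → ℚ.0ℚ ℚ.≤ λs i) ×
    (∀ j → x j ≡ sumℚ (λ i → λs i ℚ.* toℚ (liftPt V i j)))

InP : ∀ {d k} → (Fin k → Fin d → ℤ) → (Fin (suc d) → ℚ) → Set
InP V x = (x zero ≡ ℚ.1ℚ) × InCone V x

LatPt : ∀ {d k} → (Fin k → Fin d → ℤ) → ℕ → (Fin (suc d) → ℤ) → Set
LatPt V t y = (y zero ≡ + t) × InCone V (λ j → toℚ (y j))

FullDim : ∀ {d k} → (Fin k → Fin d → ℤ) → Set
FullDim {d} {k} V = ∀ (x : Fin (suc d) → ℚ) →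
  Σ (Fin k → ℚ) λ μ → ∀ j → x j ≡ sumℚ (λ i → μ i ℚ.* toℚ (liftPt V i j))

HasCard : ∀ {m} → ((Fin m → ℤ) → Set) → ℕ → Set
HasCard {m} A n =
  Σ (Fin n → Fin m → ℤ) λ e →
    (∀ i → A (e i)) ×
    (∀ y → A y → ∃ λ i → ∀ j → e i j ≡ y j) ×
    (∀ i i' → (∀ j → e i j ≡ e i' j) → i ≡ i')

module _ {c ℓ : Level} (G : Group c ℓ) where
  open Group G

  IsFinite : Set (c ⊔ ℓ)
  IsFinite = Σ ℕ λ n → Σ (Fin n → Carrier) λ f → ∀ g → ∃ λ i → f i ≈ g

  record IsSubgroup (S : Carrier → Set ℓ) : Set (c ⊔ ℓ) where
    field
      resp  : ∀ {x y} → x ≈ y → S x → S y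
      ε∈    : S ε
      ∙∈    : ∀ {x y} → S x → S y → S (x ∙ y)
      ⁻¹∈   : ∀ {x} → S x → S (x ⁻¹)

  -- ρ : G → GL(M') a group homomorphism (invertibility follows)
  record IsRep {n : ℕ} (ρ : Carrier → Mat n n) : Set (c ⊔ ℓ) where
    field
      ρ-cong : ∀ {x y} → x ≈ y → ∀ i j → ρ x i j ≡ ρ y i j
      ρ-hom  : ∀ x y i j → ρ (x ∙ y) i j ≡ (ρ x ·M ρ y) i j
      ρ-ε    : ∀ i j → ρ ε i j ≡ idM i j

  -- coefficient of z^t in H*(P;z) = (Σ_t χ_{tP} z^t) · det(I - z·ρ),
  -- evaluated at g (the character ring R(G) embeds in class functions)
  Hcoef : ∀ {d} → (Carrier → Mat (suc d) (suc d)) → (ℕ → Carrier → ℕ) →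
          ℕ → Carrier → ℤ
  Hcoef ρ χ t g =
    sumRange t (λ i → coeff (detIminuszA (ρ g)) i ℤ.* (+ χ (t ∸ i) g))

  HIsPolyOn : ∀ {d} → (Carrier → Set ℓ) → (Carrier → Mat (suc d) (suc d)) →
              (ℕ → Carrier → ℕ) → Set (c ⊔ ℓ)
  HIsPolyOn S ρ χ = Σ ℕ λ N → ∀ t → N ≤ t → ∀ g → S g → Hcoef ρ χ t g ≡ + 0

{-# OPTIONS --safe #-}
module Submission where

open import Defs
open import Level using (Level; Lift; lift)
open import Data.Nat using (ℕ; suc)
open import Data.Integer using (ℤ)
open import Data.Rational using (ℚ)
open import Data.Fin using (Fin; zero)
open import Data.Product using (Σ; ∃; _×_; _,_)
open import Data.Unit using (⊤; tt)
open import Relation.Binary.PropositionalEquality using (_≡_)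
open import Algebra.Bundles using (Group)

-- The coefficients of H* are class functions evaluated pointwise, so the
-- H*-series of a subgroup is the restriction of that of the larger group.
HIsPolyOn-mono : ∀ {c ℓ d} (G : Group c ℓ) {S T : Group.Carrier G → Set ℓ}
                 (ρ : Group.Carrier G → Mat (suc d) (suc d)) (χ : ℕ → Group.Carrier G → ℕ) →
                 (∀ {g} → S g → T g) → HIsPolyOn G T ρ χ → HIsPolyOn G S ρ χ
HIsPolyOn-mono G ρ χ S⊆T (N , vanish) = N , λ t N≤t g g∈S → vanish t N≤t g (S⊆T g∈S)

theorem2p13 : ∀ {c ℓ : Level} (G : Group c ℓ) → IsFinite G →
    (d : ℕ) (ρ : Group.Carrier G → Mat (suc d) (suc d)) → IsRep G ρ →
    (∀ g (y : Fin (suc d) → ℤ) → act (ρ g) y zero ≡ y zero) →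
    (k : ℕ) (V : Fin k → Fin d → ℤ) → FullDim V →
    (∀ g (x : Fin (suc d) → ℚ) → InP V x → InP V (actℚ (ρ g) x)) →
    (∀ g (x : Fin (suc d) → ℚ) → InP V x →
       ∃ λ x′ → InP V x′ × (∀ j → actℚ (ρ g) x′ j ≡ x j)) →
    (χ : ℕ → Group.Carrier G → ℕ) →
    (∀ t g → HasCard (λ y → LatPt V t y × (∀ j → act (ρ g) y j ≡ y j)) (χ t g)) →
    (𝓗 : Group.Carrier G → Set ℓ) → IsSubgroup G 𝓗 →
    HIsPolyOn G (λ _ → Lift ℓ ⊤) ρ χ →
    HIsPolyOn G 𝓗 ρ χ
theorem2p13 G _ d ρ _ _ k V _ _ _ χ _ 𝓗 _ =
  HIsPolyOn-mono G ρ χ (λ _ → lift tt)
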